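{- Let $\Sigma$ be a monoidal signature. Two morphism expressions over $\Sigma$ with the same domain and the same codomain denote the same morphism of the free strict monoidal category on $\Sigma$ if and only if their associated labelled diagrams are related by a finite sequence of right and left exchanges.
   Context: A monoidal signature $\Sigma$ consists of a set of generating objects and a set of generators, each generator $f$ having a domain and a codomain which are finite words over the generating objects. Morphism expressions are built from generators, identities $1_A$ ($A$ a word), composites $f\circ g$ (defined when the codomain of $g$ equals the domain of $f$; $g$ is applied first) and tensor products $f\otimes g$; each denotes a morphism of the free strict monoidal category on $\Sigma$. A labelled diagram is a tuple $(S,N,H,I,O,L)$ with $S,N\in\mathbb N$, functions $H,I,O:\{0,\dots,N-1\}\to\mathbb N$ and a labelling $L$ of $\{0,\dots,N-1\}$ by generators. The labelled diagram of an expression $\phi$ with domain of length $a$ is $(a,N,H,I,O,L)$ where the list of triples $(H(n),I(n),O(n))$ with labels $L(n)$, $n=0,\dots,N-1$, is produced by the following recursive procedure $\mathrm{conv}(\phi,\mathrm{offset})$ (started with offset $0$ and an empty list), which appends entries to the list and returns the pair (number of inputs, number of outputs) of $\phi$: for $\phi=f\circ g$, run $\mathrm{conv}(g,\mathrm{offset})$ returning $(a,b)$, then $\mathrm{conv}(f,\mathrm{offset})$ returning $(b,c)$, and return $(a,c)$; for $\phi=f\otimes g$, run $\mathrm{conv}(f,\mathrm{offset})$ returning $(a,b)$, then $\mathrm{conv}(g,\mathrm{offset}+b)$ returning $(c,d)$, and return $(a+c,b+d)$; for a generator $f$ with $a$ inputs and $b$ outputs (lengths of its domain and codomain), append the entry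 $(\mathrm{offset},a,b)$ labelled $f$ and return $(a,b)$; for $1_A$ with $A$ of length $l$, append nothing and return $(l,l)$. Put $\Delta(n)=O(n)-I(n)$. For $0\le n\le N-2$, a labelled diagram admits a right exchange at height $n$ if $H(n+1)\ge H(n)+O(n)$; the result is identical except that $H(n),I(n),O(n),L(n)$ become $H(n+1)-\Delta(n),I(n+1),O(n+1),L(n+1)$ and $H(n+1),I(n+1),O(n+1),L(n+1)$ become $H(n),I(n),O(n),L(n)$. It admits a left exchange at height $n$ if $H(n)\ge H(n+1)+I(n+1)$; the result is identical except that $H(n),I(n),O(n),L(n)$ become $H(n+1),I(n+1),O(n+1),L(n+1)$ and $H(n+1),I(n+1),O(n+1),L(n+1)$ become $H(n)+\Delta(n+1),I(n),O(n),L(n)$. -}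

module Defs where

open import Data.Nat using (ℕ; _+_; _∸_; _≤_)
open import Data.List using (List; []; _∷_; _++_; length)
open import Data.Product using (_×_; _,_)
open import Data.Sum using (_⊎_)
open import Relation.Binary.Construct.Closure.ReflexiveTransitive using (Star)

record Signature : Set₁ where
  field
    Obj : Set
    Gen : Set
    dom : Gen → List Obj
    cod : Gen → List Obj

module _ (Sg : Signature) where
  open Signature Sg

  Word : Set
  Word = List Obj

  data Expr : Set where
    gen  : Gen → Expr
    idE  : Word → Expr
    _∘E_ : Expr → Expr → Expr     -- f ∘E g : g applied first
    _⊗E_ : Expr → Expr → Expr

  data _∶_⇒_ : Expr → Word → Word → Set where
    t-gen : (g : Gen) → gen g ∶ dom g ⇒ cod g
    t-id  : (A : Word) → idE A ∶ A ⇒ A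
    t-∘   : ∀ {f g A B C} → f ∶ B ⇒ C → g ∶ A ⇒ B → (f ∘E g) ∶ A ⇒ C
    t-⊗   : ∀ {f g A B C D} → f ∶ A ⇒ B → g ∶ C ⇒ D → (f ⊗E g) ∶ (A ++ C) ⇒ (B ++ D)

  -- Equality of morphisms in the free strict monoidal category on Sg:
  -- the congruence on well-typed expressions (of type A ⇒ B) generated by
  -- the axioms of a strict monoidal category.
  data Same : Word → Word → Expr → Expr → Set where
    ≈-refl  : ∀ {A B f} → f ∶ A ⇒ B → Same A B f f
    ≈-sym   : ∀ {A B f g} → Same A B f g → Same A B g f
    ≈-trans : ∀ {A B f g h} → Same A B f g → Same A B g h → Same A B f h
    ≈-∘     : ∀ {A B C f f' g g'} → Same B C f f' → Same A B g g' →
              Same A C (f ∘E g) (f' ∘E g')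
    ≈-⊗     : ∀ {A B C D f f' g g'} → Same A B f f' → Same C D g g' →
              Same (A ++ C) (B ++ D) (f ⊗E g) (f' ⊗E g')
    ∘-assoc : ∀ {A B C D f g h} → f ∶ C ⇒ D → g ∶ B ⇒ C → h ∶ A ⇒ B →
              Same A D ((f ∘E g) ∘E h) (f ∘E (g ∘E h))
    ∘-idˡ   : ∀ {A B f} → f ∶ A ⇒ B → Same A B (idE B ∘E f) f
    ∘-idʳ   : ∀ {A B f} → f ∶ A ⇒ B → Same A B (f ∘E idE A) f
    ⊗-assoc : ∀ {A B C D E F f g h} → f ∶ A ⇒ B → g ∶ C ⇒ D → h ∶ E ⇒ F →
              Same (A ++ C ++ E) (B ++ D ++ F) ((f ⊗E g) ⊗E h) (f ⊗E (g ⊗E h))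
    ⊗-unitˡ : ∀ {A B f} → f ∶ A ⇒ B → Same A B (idE [] ⊗E f) f
    ⊗-unitʳ : ∀ {A B f} → f ∶ A ⇒ B → Same A B (f ⊗E idE []) f
    ⊗-id    : (A B : Word) → Same (A ++ B) (A ++ B) (idE A ⊗E idE B) (idE (A ++ B))
    interchange : ∀ {A B C D E F f g h k} →
              f ∶ B ⇒ C → g ∶ A ⇒ B → h ∶ E ⇒ F → k ∶ D ⇒ E →
              Same (A ++ D) (C ++ F) ((f ⊗E h) ∘E (g ⊗E k)) ((f ∘E g) ⊗E (h ∘E k))

  -- Labelled diagrams: the functions H, I, O, L on {0,…,N-1} are given as
  -- the list of their values (entry n = (H n, I n, O n, L n)), N = length.
  record Entry : Set where
    constructor ⟨_,_,_,_⟩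
    field
      H : ℕ
      I : ℕ
      O : ℕ
      L : Gen

  record Diagram : Set where
    constructor diagram
    field
      S       : ℕ
      entries : List Entry

  -- conv(φ, offset): returns the appended entries and (inputs, outputs).
  conv : Expr → ℕ → List Entry × ℕ × ℕ
  conv (gen g) off = (⟨ off , length (dom g) , length (cod g) , g ⟩ ∷ []) , length (dom g) , length (cod g)
  conv (idE A) off = [] , length A , length A
  conv (f ∘E g) off with conv g off | conv f off
  ... | lg , a , _ | lf , _ , c = lg ++ lf , a , c
  conv (f ⊗E g) off with conv f off
  ... | lf , a , b with conv g (off + b)
  ... | lg , c , d = lf ++ lg , a + c , b + d

  labelledDiagram : Expr → Diagram
  labelledDiagram φ with conv φ 0
  ... | es , a , _ = diagram a es

  -- Right exchange at some height n (n = position in the list).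
  data RightExL : List Entry → List Entry → Set where
    here  : ∀ {h i o l h' i' o' l' rest} → h + o ≤ h' →
            RightExL (⟨ h , i , o , l ⟩ ∷ ⟨ h' , i' , o' , l' ⟩ ∷ rest)
                     (⟨ (h' + i) ∸ o , i' , o' , l' ⟩ ∷ ⟨ h , i , o , l ⟩ ∷ rest)
    there : ∀ {e xs ys} → RightExL xs ys → RightExL (e ∷ xs) (e ∷ ys)

  data LeftExL : List Entry → List Entry → Set where
    here  : ∀ {h i o l h' i' o' l' rest} → h' + i' ≤ h →
            LeftExL (⟨ h , i , o , l ⟩ ∷ ⟨ h' , i' , o' , l' ⟩ ∷ rest)
                    (⟨ h' , i' , o' , l' ⟩ ∷ ⟨ (h + o') ∸ i' , i , o , l ⟩ ∷ rest)
    there : ∀ {e xs ys} → LeftExL xs ys → LeftExL (e ∷ xs) (e ∷ ys)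

  data Exchange : Diagram → Diagram → Set where
    right : ∀ {s xs ys} → RightExL xs ys → Exchange (diagram s xs) (diagram s ys)
    left  : ∀ {s xs ys} → LeftExL xs ys → Exchange (diagram s xs) (diagram s ys)

  Exchanges : Diagram → Diagram → Set
  Exchanges = Star Exchange

module Submission where

-- (⇐) A list of entries, read on an input word A, has a readback: the composite
-- of its layers 1_P ⊗ l ⊗ 1_S.  The diagram of every expression reads back to an
-- equal expression (generators are single boxes, composition concatenates,
-- tensor places the two diagrams side by side).  An exchange only swaps two
-- consecutive layers acting on disjoint wires, and such layers commute by the
-- interchange law; so exchange-related diagrams have equal readbacks.
--
-- (⇒) Exchanges on entry lists are symmetric (a right exchange is undone by a
-- left one) and can be performed inside longer lists.  By induction on the
-- derivation of φ = ψ, every axiom but interchange gives literally equal lists;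
-- for interchange the diagram of k slides, box by box, past the diagram of f,
-- which works because every diagram keeps its boxes within its current width.

open import Defs
open import Data.Nat using (ℕ; _+_; _∸_; _≤_; s≤s)
open import Data.Nat.Properties
open import Data.List using (List; []; _∷_; _++_; length; take; drop; map)
open import Data.List.Properties using (++-assoc; ++-identityʳ; length-++; ∷-injective; map-++; drop-drop)
open import Data.Product using (_×_; _,_; proj₁; proj₂; Σ-syntax)
open import Data.Sum using (_⊎_; inj₁; inj₂)
open import Data.Unit using (⊤; tt)
open import Relation.Binary.PropositionalEquality
open import Relation.Binary.Construct.Closure.ReflexiveTransitive using (Star; ε; _◅_; _◅◅_; reverse; gmap)
open import Relation.Binary.Construct.Closure.ReflexiveTransitive.Properties using (module StarReasoning)
open import Data.Nat.Tactic.RingSolver using (solve-∀)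

module _ {X : Set} where

  ++-equidivisible : (P Y Z V : List X) → P ++ Y ≡ Z ++ V → length P ≤ length Z →
                     Σ[ M ∈ List X ] (Z ≡ P ++ M) × (Y ≡ M ++ V)
  ++-equidivisible []      Y Z       V eq _         = Z , refl , eq
  ++-equidivisible (x ∷ P) Y (z ∷ Z) V eq (s≤s le) with ∷-injective eq
  ... | refl , eq′ with ++-equidivisible P Y Z V eq′ le
  ... | M , refl , refl = M , refl , refl

  take-length-++ : (P Y : List X) → take (length P) (P ++ Y) ≡ P
  take-length-++ []      Y = refl
  take-length-++ (x ∷ P) Y = cong (x ∷_) (take-length-++ P Y)

  drop-length-++ : (P Y : List X) → drop (length P) (P ++ Y) ≡ Y
  drop-length-++ []      Y = refl
  drop-length-++ (x ∷ P) Y = drop-length-++ P Y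

  ++-assoc-middle : (P Q M Y : List X) → (P ++ Q ++ M) ++ Y ≡ P ++ Q ++ M ++ Y
  ++-assoc-middle P Q M Y = trans (++-assoc P (Q ++ M) Y) (cong (P ++_) (++-assoc Q M Y))

  drop-middle : (P Q S : List X) → drop (length P + length Q) (P ++ Q ++ S) ≡ S
  drop-middle P Q S = begin
    drop (length P + length Q) (P ++ Q ++ S)   ≡⟨ drop-drop (length P) (length Q) (P ++ Q ++ S) ⟨
    drop (length Q) (drop (length P) (P ++ Q ++ S)) ≡⟨ cong (drop (length Q)) (drop-length-++ P (Q ++ S)) ⟩
    drop (length Q) (Q ++ S)                   ≡⟨ drop-length-++ Q S ⟩
    S                                          ∎
    where open ≡-Reasoning

module _ (Sg : Signature) where
  open Signature Sg

  Wrd : Set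
  Wrd = Word Sg

  Exp : Set
  Exp = Expr Sg

  Ent : Set
  Ent = Entry Sg

  infix 4 _⦂_⇒_ _≋_

  _⦂_⇒_ : Exp → Wrd → Wrd → Set
  _⦂_⇒_ = _∶_⇒_ Sg

  typing-unique : ∀ {f A B A′ B′} → f ⦂ A ⇒ B → f ⦂ A′ ⇒ B′ → A ≡ A′ × B ≡ B′
  typing-unique (t-gen g)   (t-gen .g)  = refl , refl
  typing-unique (t-id A)    (t-id .A)   = refl , refl
  typing-unique (t-∘ p q)   (t-∘ p′ q′) = proj₁ (typing-unique q q′) , proj₂ (typing-unique p p′)
  typing-unique (t-⊗ p q)   (t-⊗ p′ q′) with typing-unique p p′ | typing-unique q q′
  ... | refl , refl | refl , refl = refl , refl

  retype : ∀ {f A B A′ B′} → A ≡ A′ → B ≡ B′ → f ⦂ A ⇒ B → f ⦂ A′ ⇒ B′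
  retype refl refl t = t

  same-typed : ∀ {A B f g} → Same Sg A B f g → f ⦂ A ⇒ B × g ⦂ A ⇒ B
  same-typed (≈-refl t)     = t , t
  same-typed (≈-sym s)      = proj₂ (same-typed s) , proj₁ (same-typed s)
  same-typed (≈-trans s s′) = proj₁ (same-typed s) , proj₂ (same-typed s′)
  same-typed (≈-∘ s s′)     = t-∘ (proj₁ (same-typed s)) (proj₁ (same-typed s′)) ,
                              t-∘ (proj₂ (same-typed s)) (proj₂ (same-typed s′))
  same-typed (≈-⊗ s s′)     = t-⊗ (proj₁ (same-typed s)) (proj₁ (same-typed s′)) ,
                              t-⊗ (proj₂ (same-typed s)) (proj₂ (same-typed s′))
  same-typed (∘-assoc p q r) = t-∘ (t-∘ p q) r , t-∘ p (t-∘ q r)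
  same-typed (∘-idˡ p)      = t-∘ (t-id _) p , p
  same-typed (∘-idʳ p)      = t-∘ p (t-id _) , p
  same-typed (⊗-assoc {A} {B} {C} {D} {E} {F} p q r) =
    retype (++-assoc A C E) (++-assoc B D F) (t-⊗ (t-⊗ p q) r) , t-⊗ p (t-⊗ q r)
  same-typed (⊗-unitˡ p)    = t-⊗ (t-id []) p , p
  same-typed (⊗-unitʳ {A} {B} p) =
    retype (++-identityʳ A) (++-identityʳ B) (t-⊗ p (t-id [])) , p
  same-typed (⊗-id A B)     = t-⊗ (t-id A) (t-id B) , t-id _
  same-typed (interchange p q r s) = t-∘ (t-⊗ p r) (t-⊗ q s) , t-⊗ (t-∘ p q) (t-∘ r s)

  -- Since typing is unique,
  -- this is a congruence and can be chained without tracking the (propositionally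
  -- but not definitionally equal) types that the axioms produce.
  _≋_ : Exp → Exp → Set
  f ≋ g = Σ[ A ∈ Wrd ] Σ[ B ∈ Wrd ] Same Sg A B f g

  axiom : ∀ {A B f g} → Same Sg A B f g → f ≋ g
  axiom s = _ , _ , s

  ≋⇒Same : ∀ {f g A B} → f ⦂ A ⇒ B → f ≋ g → Same Sg A B f g
  ≋⇒Same t (_ , _ , s) with typing-unique (proj₁ (same-typed s)) t
  ... | refl , refl = s

  ≋-refl : ∀ {f A B} → f ⦂ A ⇒ B → f ≋ f
  ≋-refl t = axiom (≈-refl t)

  ≡⇒≋ : ∀ {f g A B} → f ≡ g → f ⦂ A ⇒ B → f ≋ g
  ≡⇒≋ refl t = ≋-refl t

  ≋-sym : ∀ {f g} → f ≋ g → g ≋ f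
  ≋-sym (_ , _ , s) = axiom (≈-sym s)

  ≋-trans : ∀ {f g h} → f ≋ g → g ≋ h → f ≋ h
  ≋-trans (_ , _ , s) (_ , _ , s′) with typing-unique (proj₁ (same-typed s′)) (proj₂ (same-typed s))
  ... | refl , refl = axiom (≈-trans s s′)

  ≋-typed : ∀ {f g A B} → f ≋ g → g ⦂ A ⇒ B → f ⦂ A ⇒ B
  ≋-typed (_ , _ , s) t with typing-unique (proj₂ (same-typed s)) t
  ... | refl , refl = proj₁ (same-typed s)

  ≋-∘ : ∀ {f f′ g g′ A C} → (f ∘E g) ⦂ A ⇒ C → f ≋ f′ → g ≋ g′ → (f ∘E g) ≋ (f′ ∘E g′)
  ≋-∘ (t-∘ p q) s s′ = axiom (≈-∘ (≋⇒Same p s) (≋⇒Same q s′))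

  ≋-⊗ : ∀ {f f′ g g′} → f ≋ f′ → g ≋ g′ → (f ⊗E g) ≋ (f′ ⊗E g′)
  ≋-⊗ (_ , _ , s) (_ , _ , s′) = axiom (≈-⊗ s s′)

  infixr 2 _≋⟨_⟩_
  _≋⟨_⟩_ : ∀ f {g h} → f ≋ g → g ≋ h → f ≋ h
  f ≋⟨ p ⟩ q = ≋-trans p q

  ⊗-id-split : ∀ {z Y Y′} (X Z : Wrd) → z ⦂ Y ⇒ Y′ → (idE (X ++ Z) ⊗E z) ≋ (idE X ⊗E (idE Z ⊗E z))
  ⊗-id-split X Z t =
    _ ≋⟨ ≋-⊗ (≋-sym (axiom (⊗-id X Z))) (≋-refl t) ⟩
    axiom (⊗-assoc (t-id X) (t-id Z) t)

  ∘-⊗-id : ∀ {f g A B C} (K : Wrd) → f ⦂ B ⇒ C → g ⦂ A ⇒ B →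
           ((f ∘E g) ⊗E idE K) ≋ ((f ⊗E idE K) ∘E (g ⊗E idE K))
  ∘-⊗-id K p q =
    _ ≋⟨ ≋-⊗ (≋-refl (t-∘ p q)) (≋-sym (axiom (∘-idˡ (t-id K)))) ⟩
    ≋-sym (axiom (interchange p q (t-id K) (t-id K)))

  id-⊗-∘ : ∀ {f g A B C} (K : Wrd) → f ⦂ B ⇒ C → g ⦂ A ⇒ B →
           (idE K ⊗E (f ∘E g)) ≋ ((idE K ⊗E f) ∘E (idE K ⊗E g))
  id-⊗-∘ K p q =
    _ ≋⟨ ≋-⊗ (≋-sym (axiom (∘-idˡ (t-id K)))) (≋-refl (t-∘ p q)) ⟩
    ≋-sym (axiom (interchange (t-id K) (t-id K) p q))

  ⊗-as-a-then-G : ∀ {a G Da Ca Y Y′} → a ⦂ Da ⇒ Ca → G ⦂ Y ⇒ Y′ →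
                  ((idE Ca ⊗E G) ∘E (a ⊗E idE Y)) ≋ (a ⊗E G)
  ⊗-as-a-then-G {Ca = Ca} {Y = Y} ta tG =
    _ ≋⟨ axiom (interchange (t-id Ca) ta tG (t-id Y)) ⟩
    ≋-⊗ (axiom (∘-idˡ ta)) (axiom (∘-idʳ tG))

  ⊗-as-G-then-a : ∀ {a G Da Ca Y Y′} → a ⦂ Da ⇒ Ca → G ⦂ Y ⇒ Y′ →
                  ((a ⊗E idE Y′) ∘E (idE Da ⊗E G)) ≋ (a ⊗E G)
  ⊗-as-G-then-a {Da = Da} {Y′ = Y′} ta tG =
    _ ≋⟨ axiom (interchange ta (t-id Da) (t-id Y′) tG) ⟩
    ≋-⊗ (axiom (∘-idʳ ta)) (axiom (∘-idˡ tG))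

  lay : Wrd → Gen → Wrd → Exp
  lay P a S = idE P ⊗E (gen a ⊗E idE S)

  lay-typed : ∀ P a S → lay P a S ⦂ P ++ dom a ++ S ⇒ P ++ cod a ++ S
  lay-typed P a S = t-⊗ (t-id P) (t-⊗ (t-gen a) (t-id S))

  lay-++-right : ∀ P a S C → lay P a (S ++ C) ≋ (lay P a S ⊗E idE C)
  lay-++-right P a S C = ≋-sym (
    _ ≋⟨ axiom (⊗-assoc (t-id P) (t-⊗ (t-gen a) (t-id S)) (t-id C)) ⟩
    _ ≋⟨ ≋-⊗ (≋-refl (t-id P)) (axiom (⊗-assoc (t-gen a) (t-id S) (t-id C))) ⟩
    ≋-⊗ (≋-refl (t-id P)) (≋-⊗ (≋-refl (t-gen a)) (axiom (⊗-id S C))))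

  lay-++-left : ∀ B P a S → lay (B ++ P) a S ≋ (idE B ⊗E lay P a S)
  lay-++-left B P a S = ⊗-id-split B P (t-⊗ (t-gen a) (t-id S))

  layers-commute : ∀ P M R a b →
    (lay (P ++ cod a ++ M) b R ∘E lay P a (M ++ dom b ++ R)) ≋
    (lay P a (M ++ cod b ++ R) ∘E lay (P ++ dom a ++ M) b R)
  layers-commute P M R a b =
    _ ≋⟨ ≋-∘ (t-∘ (retype (++-assoc-middle P (cod a) M (dom b ++ R)) (++-assoc-middle P (cod a) M (cod b ++ R))
                          (lay-typed (P ++ cod a ++ M) b R))
                  (lay-typed P a (M ++ dom b ++ R)))
             (split-left (cod a)) (≋-refl (lay-typed P a (M ++ dom b ++ R))) ⟩
    _ ≋⟨ ≋-sym (id-⊗-∘ P (t-⊗ (t-id (cod a)) tb) (t-⊗ (t-gen a) (t-id (M ++ dom b ++ R)))) ⟩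
    _ ≋⟨ ≋-⊗ (≋-refl (t-id P)) (⊗-as-a-then-G (t-gen a) tb) ⟩
    _ ≋⟨ ≋-⊗ (≋-refl (t-id P)) (≋-sym (⊗-as-G-then-a (t-gen a) tb)) ⟩
    _ ≋⟨ id-⊗-∘ P (t-⊗ (t-gen a) (t-id (M ++ cod b ++ R))) (t-⊗ (t-id (dom a)) tb) ⟩
    ≋-∘ (t-∘ (lay-typed P a (M ++ cod b ++ R)) (t-⊗ (t-id P) (t-⊗ (t-id (dom a)) tb)))
        (≋-refl (lay-typed P a (M ++ cod b ++ R))) (≋-sym (split-left (dom a)))
    where
    tb : lay M b R ⦂ M ++ dom b ++ R ⇒ M ++ cod b ++ R
    tb = lay-typed M b R
    split-left : ∀ X → lay (P ++ X ++ M) b R ≋ (idE P ⊗E (idE X ⊗E lay M b R))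
    split-left X = _ ≋⟨ lay-++-left P (X ++ M) b R ⟩ ≋-⊗ (≋-refl (t-id P)) (lay-++-left X M b R)

  -- Reading a labelled diagram back as an expression.  The entry ⟨ h , i , o , l ⟩,
  -- read on the word A, is the layer applying l to the letters h, …, h+i-1 of A.

  next : Wrd → Ent → Wrd
  next A ⟨ h , i , o , l ⟩ = take h A ++ cod l ++ drop (h + i) A

  layer : Wrd → Ent → Exp
  layer A ⟨ h , i , o , l ⟩ = lay (take h A) l (drop (h + i) A)

  readback : Wrd → List Ent → Exp
  readback A []       = idE A
  readback A (e ∷ xs) = readback (next A e) xs ∘E layer A e

  output : Wrd → List Ent → Wrd
  output A []       = A
  output A (e ∷ xs) = output (next A e) xs

  box : Wrd → Gen → Ent
  box P a = ⟨ length P , length (dom a) , length (cod a) , a ⟩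

  Fits : Wrd → Ent → Set
  Fits A ⟨ h , i , o , l ⟩ = Σ[ P ∈ Wrd ] Σ[ S ∈ Wrd ]
    (A ≡ P ++ dom l ++ S) × (h ≡ length P) × (i ≡ length (dom l)) × (o ≡ length (cod l))

  Valid : Wrd → List Ent → Set
  Valid A []       = ⊤
  Valid A (e ∷ xs) = Fits A e × Valid (next A e) xs

  fits-box : ∀ {A} P a S → A ≡ P ++ dom a ++ S → Fits A (box P a)
  fits-box P a S eq = P , S , eq , refl , refl , refl

  next-at : ∀ {A h} P a S → A ≡ P ++ dom a ++ S → h ≡ length P →
            next A ⟨ h , length (dom a) , length (cod a) , a ⟩ ≡ P ++ cod a ++ S
  next-at P a S refl refl = cong₂ (λ X Y → X ++ cod a ++ Y) (take-length-++ P _) (drop-middle P (dom a) S)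

  layer-at : ∀ {A h} P a S → A ≡ P ++ dom a ++ S → h ≡ length P →
             layer A ⟨ h , length (dom a) , length (cod a) , a ⟩ ≡ lay P a S
  layer-at P a S refl refl = cong₂ (λ X Y → lay X a Y) (take-length-++ P _) (drop-middle P (dom a) S)

  layer-typed : ∀ A e → Fits A e → layer A e ⦂ A ⇒ next A e
  layer-typed A ⟨ _ , _ , _ , l ⟩ (P , S , eq , refl , refl , refl) =
    subst (λ f → f ⦂ A ⇒ next A (box P l)) (sym (layer-at P l S eq refl))
      (retype (sym eq) (sym (next-at P l S eq refl)) (lay-typed P l S))

  readback-typed : ∀ A xs → Valid A xs → readback A xs ⦂ A ⇒ output A xs
  readback-typed A []       _       = t-id A
  readback-typed A (e ∷ xs) (f , v) = t-∘ (readback-typed (next A e) xs v) (layer-typed A e f)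

  valid-++ : ∀ A xs ys → Valid A xs → Valid (output A xs) ys → Valid A (xs ++ ys)
  valid-++ A []       ys _       w = w
  valid-++ A (e ∷ xs) ys (f , v) w = f , valid-++ (next A e) xs ys v w

  output-++ : ∀ A xs ys → output A (xs ++ ys) ≡ output (output A xs) ys
  output-++ A []       ys = refl
  output-++ A (e ∷ xs) ys = output-++ (next A e) xs ys

  readback-++ : ∀ A xs ys → Valid A xs → Valid (output A xs) ys →
                readback A (xs ++ ys) ≋ (readback (output A xs) ys ∘E readback A xs)
  readback-++ A []       ys _       w = ≋-sym (axiom (∘-idʳ (readback-typed A ys w)))
  readback-++ A (e ∷ xs) ys (f , v) w =
    _ ≋⟨ ≋-∘ (t-∘ (readback-typed _ (xs ++ ys) (valid-++ _ xs ys v w)) (layer-typed A e f))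
             (readback-++ (next A e) xs ys v w) (≋-refl (layer-typed A e f)) ⟩
    axiom (∘-assoc (readback-typed _ ys w) (readback-typed _ xs v) (layer-typed A e f))

  record Represents (A : Wrd) (xs : List Ent) (B : Wrd) (f : Exp) : Set where
    constructor represents
    field
      valid   : Valid A xs
      ends-in : output A xs ≡ B
      reads   : f ≋ readback A xs

  frame-right : ∀ A C xs → Valid A xs →
                Represents (A ++ C) xs (output A xs ++ C) (readback A xs ⊗E idE C)
  frame-right A C []       _ = represents tt refl (axiom (⊗-id A C))
  frame-right _ C (⟨ _ , _ , _ , l ⟩ ∷ xs) ((P , S , refl , refl , refl , refl) , v) =
    represents valid′ (trans (cong (λ X → output X xs) next-eq) ends-in) reads′
    where
    A : Wrd
    A = P ++ dom l ++ S
    e : Ent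
    e = box P l
    open Represents (frame-right (next A e) C xs v)
    split : A ++ C ≡ P ++ dom l ++ S ++ C
    split = trans (++-assoc P (dom l ++ S) C) (cong (P ++_) (++-assoc (dom l) S C))
    next-eq : next (A ++ C) e ≡ next A e ++ C
    next-eq = begin
      next (A ++ C) e        ≡⟨ next-at P l (S ++ C) split refl ⟩
      P ++ cod l ++ S ++ C   ≡⟨ trans (++-assoc P (cod l ++ S) C) (cong (P ++_) (++-assoc (cod l) S C)) ⟨
      (P ++ cod l ++ S) ++ C ≡⟨ cong (_++ C) (next-at P l S refl refl) ⟨
      next A e ++ C          ∎
      where open ≡-Reasoning
    valid′ : Valid (A ++ C) (e ∷ xs)
    valid′ = fits-box P l (S ++ C) split , subst (λ X → Valid X xs) (sym next-eq) valid
    t-rest : readback (next A e) xs ⦂ next A e ⇒ output (next A e) xs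
    t-rest = readback-typed (next A e) xs v
    t-layer : layer A e ⦂ A ⇒ next A e
    t-layer = layer-typed A e (fits-box P l S refl)
    reads′ : (readback A (e ∷ xs) ⊗E idE C) ≋ readback (A ++ C) (e ∷ xs)
    reads′ =
      _ ≋⟨ ∘-⊗-id C t-rest t-layer ⟩
      _ ≋⟨ ≋-∘ (t-∘ (t-⊗ t-rest (t-id C)) (t-⊗ t-layer (t-id C))) reads
               (≋-trans (≡⇒≋ (cong (_⊗E idE C) (layer-at P l S refl refl)) (t-⊗ t-layer (t-id C)))
                        (≋-sym (lay-++-right P l S C))) ⟩
      ≋-sym (≡⇒≋ (cong₂ (λ X f → readback X xs ∘E f) next-eq (layer-at P l (S ++ C) split refl))
                 (readback-typed (A ++ C) (e ∷ xs) valid′))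

  shiftE : ℕ → Ent → Ent
  shiftE k ⟨ h , i , o , l ⟩ = ⟨ k + h , i , o , l ⟩

  shift : ℕ → List Ent → List Ent
  shift k = map (shiftE k)

  frame-left : ∀ B C xs → Valid C xs →
               Represents (B ++ C) (shift (length B) xs) (B ++ output C xs) (idE B ⊗E readback C xs)
  frame-left B C []       _ = represents tt refl (axiom (⊗-id B C))
  frame-left B _ (⟨ _ , _ , _ , l ⟩ ∷ xs) ((P , S , refl , refl , refl , refl) , v) =
    represents valid′ (trans (cong (λ X → output X (shift (length B) xs)) next-eq) ends-in) reads′
    where
    C : Wrd
    C = P ++ dom l ++ S
    e e′ : Ent
    e = box P l
    e′ = shiftE (length B) e
    open Represents (frame-left B (next C e) xs v)
    split : B ++ C ≡ (B ++ P) ++ dom l ++ S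
    split = sym (++-assoc B P (dom l ++ S))
    height : length B + length P ≡ length (B ++ P)
    height = sym (length-++ B)
    next-eq : next (B ++ C) e′ ≡ B ++ next C e
    next-eq = begin
      next (B ++ C) e′       ≡⟨ next-at (B ++ P) l S split height ⟩
      (B ++ P) ++ cod l ++ S ≡⟨ ++-assoc B P (cod l ++ S) ⟩
      B ++ P ++ cod l ++ S   ≡⟨ cong (B ++_) (next-at P l S refl refl) ⟨
      B ++ next C e          ∎
      where open ≡-Reasoning
    valid′ : Valid (B ++ C) (e′ ∷ shift (length B) xs)
    valid′ = (B ++ P , S , split , height , refl , refl) ,
             subst (λ X → Valid X (shift (length B) xs)) (sym next-eq) valid
    t-rest : readback (next C e) xs ⦂ next C e ⇒ output (next C e) xs
    t-rest = readback-typed (next C e) xs v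
    t-layer : layer C e ⦂ C ⇒ next C e
    t-layer = layer-typed C e (fits-box P l S refl)
    reads′ : (idE B ⊗E readback C (e ∷ xs)) ≋ readback (B ++ C) (e′ ∷ shift (length B) xs)
    reads′ =
      _ ≋⟨ id-⊗-∘ B t-rest t-layer ⟩
      _ ≋⟨ ≋-∘ (t-∘ (t-⊗ (t-id B) t-rest) (t-⊗ (t-id B) t-layer)) reads
               (≋-trans (≡⇒≋ (cong (idE B ⊗E_) (layer-at P l S refl refl)) (t-⊗ (t-id B) t-layer))
                        (≋-sym (lay-++-left B P l S))) ⟩
      ≋-sym (≡⇒≋ (cong₂ (λ X f → readback X (shift (length B) xs) ∘E f) next-eq
                        (layer-at (B ++ P) l S split height))
                 (readback-typed (B ++ C) (e′ ∷ shift (length B) xs) valid′))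

  represents-typed : ∀ {A xs B f} → Represents A xs B f → f ⦂ A ⇒ B
  represents-typed {A} {xs} (represents v refl r) = ≋-typed r (readback-typed A xs v)

  represents-≋ : ∀ {A xs B f g} → f ≋ g → Represents A xs B g → Represents A xs B f
  represents-≋ s (represents v o r) = represents v o (≋-trans s r)

  represents-gen : ∀ g → Represents (dom g) (box [] g ∷ []) (cod g) (gen g)
  represents-gen g = represents (fits-box [] g [] split , tt)
                               (trans (next-at [] g [] split refl) (++-identityʳ (cod g))) reads
    where
    split : dom g ≡ [] ++ dom g ++ []
    split = sym (++-identityʳ (dom g))
    t-layer : layer (dom g) (box [] g) ⦂ dom g ⇒ next (dom g) (box [] g)
    t-layer = layer-typed (dom g) (box [] g) (fits-box [] g [] split)
    reads : gen g ≋ readback (dom g) (box [] g ∷ [])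
    reads =
      _ ≋⟨ ≋-sym (axiom (⊗-unitʳ (t-gen g))) ⟩
      _ ≋⟨ ≋-sym (axiom (⊗-unitˡ (t-⊗ (t-gen g) (t-id [])))) ⟩
      _ ≋⟨ ≋-sym (≡⇒≋ (layer-at [] g [] split refl) t-layer) ⟩
      ≋-sym (axiom (∘-idˡ t-layer))

  represents-∘ : ∀ {A B C xs ys f g} → Represents B ys C f → Represents A xs B g →
                 Represents A (xs ++ ys) C (f ∘E g)
  represents-∘ {A} {xs = xs} {ys} {f} {g} R@(represents vf refl rf) S@(represents vg refl rg) =
    represents (valid-++ A xs ys vg vf) (output-++ A xs ys) reads
    where
    reads : (f ∘E g) ≋ readback A (xs ++ ys)
    reads =
      _ ≋⟨ ≋-∘ (t-∘ (represents-typed R) (represents-typed S)) rf rg ⟩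
      ≋-sym (readback-++ A xs ys vg vf)

  represents-⊗ : ∀ {A B C D xs ys f g} → Represents A xs B f → Represents C ys D g →
                 Represents (A ++ C) (xs ++ shift (length B) ys) (B ++ D) (f ⊗E g)
  represents-⊗ {A} {C = C} {xs = xs} {ys} {f} {g} (represents vf refl rf) (represents vg refl rg) =
    represents-≋ reads (represents-∘ (frame-left (output A xs) C ys vg) (frame-right A C xs vf))
    where
    reads : (f ⊗E g) ≋ ((idE (output A xs) ⊗E readback C ys) ∘E (readback A xs ⊗E idE C))
    reads =
      _ ≋⟨ ≋-⊗ rf rg ⟩
      ≋-sym (⊗-as-a-then-G (readback-typed A xs vf) (readback-typed C ys vg))

  conv-list : Exp → ℕ → List Ent
  conv-list f off = proj₁ (conv Sg f off)

  #in : Exp → ℕ → ℕ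
  #in f off = proj₁ (proj₂ (conv Sg f off))

  #out : Exp → ℕ → ℕ
  #out f off = proj₂ (proj₂ (conv Sg f off))

  #out-offset : ∀ f off off′ → #out f off ≡ #out f off′
  #out-offset (gen _)  _   _    = refl
  #out-offset (idE _)  _   _    = refl
  #out-offset (f ∘E g) off off′ = #out-offset f off off′
  #out-offset (f ⊗E g) off off′ = cong₂ _+_ (#out-offset f off off′) (#out-offset g _ _)

  conv-arity : ∀ {f A B} → f ⦂ A ⇒ B → ∀ off → #in f off ≡ length A × #out f off ≡ length B
  conv-arity (t-gen g) off = refl , refl
  conv-arity (t-id A)  off = refl , refl
  conv-arity (t-∘ p q) off = proj₁ (conv-arity q off) , proj₂ (conv-arity p off)
  conv-arity (t-⊗ {A = A} {B} p q) off =
    trans (cong₂ _+_ (proj₁ (conv-arity p off)) (proj₁ (conv-arity q _))) (sym (length-++ A)) ,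
    trans (cong₂ _+_ (proj₂ (conv-arity p off)) (proj₂ (conv-arity q _))) (sym (length-++ B))

  conv-list-shift : ∀ f k off → conv-list f (k + off) ≡ shift k (conv-list f off)
  conv-list-shift (gen _)  k off = refl
  conv-list-shift (idE _)  k off = refl
  conv-list-shift (f ∘E g) k off =
    trans (cong₂ _++_ (conv-list-shift g k off) (conv-list-shift f k off))
          (sym (map-++ (shiftE k) (conv-list g off) (conv-list f off)))
  conv-list-shift (f ⊗E g) k off =
    trans (cong₂ _++_ (conv-list-shift f k off)
            (trans (cong (conv-list g) offset-eq) (conv-list-shift g k (off + #out f off))))
          (sym (map-++ (shiftE k) (conv-list f off) (conv-list g (off + #out f off))))
    where
    offset-eq : k + off + #out f (k + off) ≡ k + (off + #out f off)
    offset-eq = trans (cong (k + off +_) (#out-offset f (k + off) off)) (+-assoc k off _)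

  conv-list-shift₀ : ∀ f k → conv-list f k ≡ shift k (conv-list f 0)
  conv-list-shift₀ f k = trans (cong (conv-list f) (sym (+-identityʳ k))) (conv-list-shift f k 0)

  conv-represents : ∀ {f A B} → f ⦂ A ⇒ B → Represents A (conv-list f 0) B f
  conv-represents (t-gen g) = represents-gen g
  conv-represents (t-id A)  = represents tt refl (≋-refl (t-id A))
  conv-represents (t-∘ p q) = represents-∘ (conv-represents p) (conv-represents q)
  conv-represents (t-⊗ {g = g} {B = B} p q)
    rewrite proj₂ (conv-arity p 0) | conv-list-shift₀ g (length B) =
    represents-⊗ (conv-represents p) (conv-represents q)

  readback-two : ∀ A e₁ e₂ rest {Z f₁ f₂} → Valid A (e₁ ∷ e₂ ∷ rest) →
                 next (next A e₁) e₂ ≡ Z → layer A e₁ ≡ f₁ → layer (next A e₁) e₂ ≡ f₂ →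
                 readback A (e₁ ∷ e₂ ∷ rest) ≋ (readback Z rest ∘E (f₂ ∘E f₁))
  readback-two A e₁ e₂ rest (fit₁ , fit₂ , v) refl refl refl =
    axiom (∘-assoc (readback-typed _ rest v) (layer-typed _ e₂ fit₂) (layer-typed A e₁ fit₁))

  module TwoBoxes (P : Wrd) (a : Gen) (M : Wrd) (b : Gen) (R : Wrd) where

    source target : Wrd
    source = P ++ dom a ++ M ++ dom b ++ R
    target = P ++ cod a ++ M ++ cod b ++ R

    a-first b-first : List Ent → List Ent
    a-first rest = box P a ∷ box (P ++ cod a ++ M) b ∷ rest
    b-first rest = box (P ++ dom a ++ M) b ∷ box P a ∷ rest

    private
      a-then : next source (box P a) ≡ (P ++ cod a ++ M) ++ dom b ++ R
      a-then = trans (next-at P a (M ++ dom b ++ R) refl refl) (sym (++-assoc-middle P (cod a) M (dom b ++ R)))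
      a-then-b : next (next source (box P a)) (box (P ++ cod a ++ M) b) ≡ target
      a-then-b = trans (next-at (P ++ cod a ++ M) b R a-then refl) (++-assoc-middle P (cod a) M (cod b ++ R))
      source-at-b : source ≡ (P ++ dom a ++ M) ++ dom b ++ R
      source-at-b = sym (++-assoc-middle P (dom a) M (dom b ++ R))
      b-then : next source (box (P ++ dom a ++ M) b) ≡ P ++ dom a ++ M ++ cod b ++ R
      b-then = trans (next-at (P ++ dom a ++ M) b R source-at-b refl) (++-assoc-middle P (dom a) M (cod b ++ R))
      b-then-a : next (next source (box (P ++ dom a ++ M) b)) (box P a) ≡ target
      b-then-a = next-at P a (M ++ cod b ++ R) b-then refl

    valid-a-first : ∀ rest → Valid target rest → Valid source (a-first rest)
    valid-a-first rest v = fits-box P a (M ++ dom b ++ R) refl , fits-box (P ++ cod a ++ M) b R a-then ,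
                           subst (λ X → Valid X rest) (sym a-then-b) v

    valid-b-first : ∀ rest → Valid target rest → Valid source (b-first rest)
    valid-b-first rest v = fits-box (P ++ dom a ++ M) b R source-at-b , fits-box P a (M ++ cod b ++ R) b-then ,
                           subst (λ X → Valid X rest) (sym b-then-a) v

    rest-of-a-first : ∀ rest → Valid source (a-first rest) → Valid target rest
    rest-of-a-first rest (_ , _ , v) = subst (λ X → Valid X rest) a-then-b v

    rest-of-b-first : ∀ rest → Valid source (b-first rest) → Valid target rest
    rest-of-b-first rest (_ , _ , v) = subst (λ X → Valid X rest) b-then-a v

    same-output : ∀ rest → output source (a-first rest) ≡ output source (b-first rest)
    same-output rest = cong (λ X → output X rest) (trans a-then-b (sym b-then-a))

    same-readback : ∀ rest → Valid target rest →
                    readback source (a-first rest) ≋ readback source (b-first rest)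
    same-readback rest v =
      _ ≋⟨ a-side ⟩
      _ ≋⟨ ≋-∘ (≋-typed (≋-sym a-side) (readback-typed source (a-first rest) (valid-a-first rest v)))
               (≋-refl (readback-typed target rest v)) (layers-commute P M R a b) ⟩
      ≋-sym (readback-two source _ _ rest (valid-b-first rest v) b-then-a
               (layer-at (P ++ dom a ++ M) b R source-at-b refl) (layer-at P a (M ++ cod b ++ R) b-then refl))
      where
      a-side : readback source (a-first rest) ≋
               (readback target rest ∘E (lay (P ++ cod a ++ M) b R ∘E lay P a (M ++ dom b ++ R)))
      a-side = readback-two source _ _ rest (valid-a-first rest v) a-then-b
                 (layer-at P a (M ++ dom b ++ R) refl refl) (layer-at (P ++ cod a ++ M) b R a-then refl)

  -- The position of the second box after exchanging it with a first box that turns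
  -- the word X into Y.
  exchanged-height : (P X Y M : Wrd) → (length (P ++ X ++ M) + length Y) ∸ length X ≡ length (P ++ Y ++ M)
  exchanged-height P X Y M = begin
    (length (P ++ X ++ M) + length Y) ∸ length X      ≡⟨ cong (λ n → (n + length Y) ∸ length X) (length-middle X) ⟩
    (length P + (length X + length M) + length Y) ∸ length X
                                                      ≡⟨ cong (_∸ length X) (rearrange (length P) (length X) (length M) (length Y)) ⟩
    (length X + (length P + (length Y + length M))) ∸ length X ≡⟨ m+n∸m≡n (length X) _ ⟩
    length P + (length Y + length M)                  ≡⟨ length-middle Y ⟨
    length (P ++ Y ++ M)                              ∎
    where
    open ≡-Reasoning
    length-middle : ∀ Q → length (P ++ Q ++ M) ≡ length P + (length Q + length M)
    length-middle Q = trans (length-++ P) (cong (length P +_) (length-++ Q))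
    rearrange : ∀ p x m y → p + (x + m) + y ≡ x + (p + (y + m))
    rearrange = solve-∀

  Agree : Wrd → List Ent → List Ent → Set
  Agree A xs ys = Valid A ys × output A xs ≡ output A ys × readback A xs ≋ readback A ys

  right-exchange-here : ∀ {A h i o l h′ i′ o′ l′ rest} → h + o ≤ h′ →
    Valid A (⟨ h , i , o , l ⟩ ∷ ⟨ h′ , i′ , o′ , l′ ⟩ ∷ rest) →
    Agree A (⟨ h , i , o , l ⟩ ∷ ⟨ h′ , i′ , o′ , l′ ⟩ ∷ rest)
            (⟨ (h′ + i) ∸ o , i′ , o′ , l′ ⟩ ∷ ⟨ h , i , o , l ⟩ ∷ rest)
  right-exchange-here {l = l} {l′ = l′} {rest} le
    v@((P , S , refl , refl , refl , refl) , (P′ , S′ , after-l , refl , refl , refl) , _)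
    with ++-equidivisible (P ++ cod l) S P′ (dom l′ ++ S′)
           (trans (++-assoc P (cod l) S) (trans (sym (next-at P l S refl refl)) after-l))
           (subst (_≤ length P′) (sym (length-++ P)) le)
  ... | M , P′-eq , refl with trans P′-eq (++-assoc P (cod l) M)
  ... | refl rewrite exchanged-height P (cod l) (dom l) M =
    valid-b-first rest w , same-output rest , same-readback rest w
    where
    open TwoBoxes P l M l′ S′
    w : Valid target rest
    w = rest-of-a-first rest v

  left-exchange-here : ∀ {A h i o l h′ i′ o′ l′ rest} → h′ + i′ ≤ h →
    Valid A (⟨ h , i , o , l ⟩ ∷ ⟨ h′ , i′ , o′ , l′ ⟩ ∷ rest) →
    Agree A (⟨ h , i , o , l ⟩ ∷ ⟨ h′ , i′ , o′ , l′ ⟩ ∷ rest)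
            (⟨ h′ , i′ , o′ , l′ ⟩ ∷ ⟨ (h + o′) ∸ i′ , i , o , l ⟩ ∷ rest)
  left-exchange-here {l = l} {l′ = l′} {rest} le
    v@((P , S , A-eq , refl , refl , refl) , (P′ , S′ , after-l , refl , refl , refl) , _)
    with ++-equidivisible (P′ ++ dom l′) S′ P (cod l ++ S)
           (trans (++-assoc P′ (dom l′) S′) (trans (sym after-l) (next-at P l S A-eq refl)))
           (subst (_≤ length P) (sym (length-++ P′)) le)
  ... | M , P-eq , refl with trans P-eq (++-assoc P′ (dom l′) M)
  ... | refl with trans A-eq (++-assoc-middle P′ (dom l′) M (dom l ++ S))
  ... | refl rewrite exchanged-height P′ (dom l′) (cod l′) M =
    valid-a-first rest w , sym (same-output rest) , ≋-sym (same-readback rest w)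
    where
    open TwoBoxes P′ l′ M l S
    w : Valid target rest
    w = rest-of-b-first rest v

  agree-cons : ∀ A e xs ys → (∀ B → Valid B xs → Agree B xs ys) → Valid A (e ∷ xs) → Agree A (e ∷ xs) (e ∷ ys)
  agree-cons A e xs ys agree (fit , v) with agree (next A e) v
  ... | v′ , same-out , same-rb =
    (fit , v′) , same-out , ≋-∘ (t-∘ (readback-typed _ xs v) (layer-typed A e fit)) same-rb (≋-refl (layer-typed A e fit))

  right-exchange-agrees : ∀ {xs ys} → RightExL Sg xs ys → ∀ A → Valid A xs → Agree A xs ys
  right-exchange-agrees (here le)               A = right-exchange-here le
  right-exchange-agrees (there {e} {xs} {ys} r) A = agree-cons A e xs ys (right-exchange-agrees r)

  left-exchange-agrees : ∀ {xs ys} → LeftExL Sg xs ys → ∀ A → Valid A xs → Agree A xs ys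
  left-exchange-agrees (here le)               A = left-exchange-here le
  left-exchange-agrees (there {e} {xs} {ys} r) A = agree-cons A e xs ys (left-exchange-agrees r)

  exchange-agrees : ∀ {d d′} → Exchange Sg d d′ → ∀ A → Valid A (Diagram.entries d) →
                    Agree A (Diagram.entries d) (Diagram.entries d′)
  exchange-agrees (right r) = right-exchange-agrees r
  exchange-agrees (left r)  = left-exchange-agrees r

  exchanges-agree : ∀ {d d′} → Exchanges Sg d d′ → ∀ A → Valid A (Diagram.entries d) →
                    Agree A (Diagram.entries d) (Diagram.entries d′)
  exchanges-agree ε        A v = v , refl , ≋-refl (readback-typed A _ v)
  exchanges-agree (x ◅ xs) A v with exchange-agrees x A v
  ... | v′ , same-out , same-rb with exchanges-agree xs A v′
  ... | v″ , same-out′ , same-rb′ = v″ , trans same-out same-out′ , ≋-trans same-rb same-rb′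

  Exch : List Ent → List Ent → Set
  Exch xs ys = RightExL Sg xs ys ⊎ LeftExL Sg xs ys

  infix 4 _⇝*_
  _⇝*_ : List Ent → List Ent → Set
  _⇝*_ = Star Exch

  right-exchange : ∀ {h i o l h′ i′ o′ l′ rest} H → h + o ≤ h′ → (h′ + i) ∸ o ≡ H →
    RightExL Sg (⟨ h , i , o , l ⟩ ∷ ⟨ h′ , i′ , o′ , l′ ⟩ ∷ rest) (⟨ H , i′ , o′ , l′ ⟩ ∷ ⟨ h , i , o , l ⟩ ∷ rest)
  right-exchange _ le refl = here le

  left-exchange : ∀ {h i o l h′ i′ o′ l′ rest} H → h′ + i′ ≤ h → (h + o′) ∸ i′ ≡ H →
    LeftExL Sg (⟨ h , i , o , l ⟩ ∷ ⟨ h′ , i′ , o′ , l′ ⟩ ∷ rest) (⟨ h′ , i′ , o′ , l′ ⟩ ∷ ⟨ H , i , o , l ⟩ ∷ rest)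
  left-exchange _ le refl = here le

  -- The arithmetic behind the inverse of an exchange: a box of width y that fits
  -- left of z still fits after z is shifted by w - y, and shifting back restores z.
  inverse-room : ∀ x y z w → x + y ≤ z → x + w ≤ (z + w) ∸ y
  inverse-room x y z w le = begin
    x + w           ≤⟨ +-monoˡ-≤ w (m+n≤o⇒m≤o∸n x le) ⟩
    (z ∸ y) + w     ≡⟨ +-∸-comm w (m+n≤o⇒n≤o x le) ⟨
    (z + w) ∸ y     ∎
    where open ≤-Reasoning

  inverse-height : ∀ x y z w → x + y ≤ z → ((z + w) ∸ y + y) ∸ w ≡ z
  inverse-height x y z w le =
    trans (cong (_∸ w) (m∸n+n≡m (≤-trans (m+n≤o⇒n≤o x le) (m≤m+n z w)))) (m+n∸n≡m z w)

  right-exchange-inverse : ∀ {xs ys} → RightExL Sg xs ys → LeftExL Sg ys xs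
  right-exchange-inverse (here {h} {i} {o} {_} {h′} le) =
    left-exchange h′ (inverse-room h o h′ i le) (inverse-height h o h′ i le)
  right-exchange-inverse (there r) = there (right-exchange-inverse r)

  left-exchange-inverse : ∀ {xs ys} → LeftExL Sg xs ys → RightExL Sg ys xs
  left-exchange-inverse (here {h} {_} {_} {_} {h′} {i′} {o′} le) =
    right-exchange h (inverse-room h′ i′ h o′ le) (inverse-height h′ i′ h o′ le)
  left-exchange-inverse (there r) = there (left-exchange-inverse r)

  exch-sym : ∀ {xs ys} → Exch xs ys → Exch ys xs
  exch-sym (inj₁ r) = inj₂ (right-exchange-inverse r)
  exch-sym (inj₂ r) = inj₁ (left-exchange-inverse r)

  ⇝*-sym : ∀ {xs ys} → xs ⇝* ys → ys ⇝* xs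
  ⇝*-sym = reverse exch-sym

  ≡⇒⇝* : ∀ {xs ys} → xs ≡ ys → xs ⇝* ys
  ≡⇒⇝* refl = ε

  exch-prefix : ∀ zs {xs ys} → Exch xs ys → Exch (zs ++ xs) (zs ++ ys)
  exch-prefix []       s        = s
  exch-prefix (z ∷ zs) s with exch-prefix zs s
  ... | inj₁ r = inj₁ (there r)
  ... | inj₂ r = inj₂ (there r)

  exch-suffix : ∀ zs {xs ys} → Exch xs ys → Exch (xs ++ zs) (ys ++ zs)
  exch-suffix zs (inj₁ r) = inj₁ (right-suffix r)
    where
    right-suffix : ∀ {xs ys} → RightExL Sg xs ys → RightExL Sg (xs ++ zs) (ys ++ zs)
    right-suffix (here le) = here le
    right-suffix (there r) = there (right-suffix r)
  exch-suffix zs (inj₂ r) = inj₂ (left-suffix r)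
    where
    left-suffix : ∀ {xs ys} → LeftExL Sg xs ys → LeftExL Sg (xs ++ zs) (ys ++ zs)
    left-suffix (here le) = here le
    left-suffix (there r) = there (left-suffix r)

  ⇝*-prefix : ∀ zs {xs ys} → xs ⇝* ys → (zs ++ xs) ⇝* (zs ++ ys)
  ⇝*-prefix zs = gmap (zs ++_) (exch-prefix zs)

  ⇝*-suffix : ∀ zs {xs ys} → xs ⇝* ys → (xs ++ zs) ⇝* (ys ++ zs)
  ⇝*-suffix zs = gmap (_++ zs) (exch-suffix zs)

  ⇝*-++ : ∀ {xs ys xs′ ys′} → xs ⇝* xs′ → ys ⇝* ys′ → (xs ++ ys) ⇝* (xs′ ++ ys′)
  ⇝*-++ {ys = ys} {xs′} p q = ⇝*-suffix ys p ◅◅ ⇝*-prefix xs′ q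

  -- Layered off w xs w′: the diagram xs turns a word of length w into one of
  -- length w′, and every box lies at least off positions from the left
  -- (a box at relative position p with r wires to its right).
  data Layered (off : ℕ) : ℕ → List Ent → ℕ → Set where
    []     : ∀ {w} → Layered off w [] w
    box-at : ∀ {w w′ xs h i o l} p r → h ≡ off + p → w ≡ p + i + r →
             Layered off (p + o + r) xs w′ → Layered off w (⟨ h , i , o , l ⟩ ∷ xs) w′

  layered-++ : ∀ {off a b c xs ys} → Layered off a xs b → Layered off b ys c → Layered off a (xs ++ ys) c
  layered-++ []                    q = q
  layered-++ (box-at p r eh ew rs) q = box-at p r eh ew (layered-++ rs q)

  layered-widen-right : ∀ {off w w′ xs} q → Layered off w xs w′ → Layered off (w + q) xs (w′ + q)
  layered-widen-right q [] = []
  layered-widen-right {off} {w′ = w′} {_ ∷ xs} q (box-at {i = i} {o = o} p r eh refl rs) =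
    box-at p (r + q) eh (+-assoc (p + i) r q)
      (subst (λ w → Layered off w xs (w′ + q)) (+-assoc (p + o) r q) (layered-widen-right q rs))

  layered-widen-left : ∀ {off w w′ xs} b → Layered (off + b) w xs w′ → Layered off (b + w) xs (b + w′)
  layered-widen-left b [] = []
  layered-widen-left {off} {w′ = w′} {_ ∷ xs} b (box-at {i = i} {o = o} p r refl refl rs) =
    box-at (b + p) r (+-assoc off b p) (regroup i)
      (subst (λ w → Layered off w xs (b + w′)) (regroup o) (layered-widen-left b rs))
    where
    regroup : ∀ n → b + (p + n + r) ≡ b + p + n + r
    regroup n = trans (cong (b +_) (+-assoc p n r)) (sym (trans (+-assoc (b + p) n r) (+-assoc b p (n + r))))

  conv-layered : ∀ {f A B} → f ⦂ A ⇒ B → ∀ off → Layered off (length A) (conv-list f off) (length B)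
  conv-layered (t-gen g) off = box-at 0 0 (sym (+-identityʳ off)) (sym (+-identityʳ _))
                                 (subst (λ w → Layered off w [] (length (cod g))) (sym (+-identityʳ _)) [])
  conv-layered (t-id A)  off = []
  conv-layered (t-∘ p q) off = layered-++ (conv-layered q off) (conv-layered p off)
  conv-layered (t-⊗ {A = A} {B} {C} {D} p q) off
    rewrite length-++ A {C} | length-++ B {D} | proj₂ (conv-arity p off) =
    layered-++ (layered-widen-right (length C) (conv-layered p off))
               (layered-widen-left (length B) (conv-layered q (off + length B)))

  slide-past : ∀ {off w w′ F} t i o l → Layered off w F w′ →
               (⟨ off + w + t , i , o , l ⟩ ∷ F) ⇝* (F ++ ⟨ off + w′ + t , i , o , l ⟩ ∷ [])
  slide-past t i o l [] = ε
  slide-past {off} t i o l (box-at {i = i′} {o = o′} p r refl refl rs) =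
    inj₂ (left-exchange (off + (p + o′ + r) + t) room height) ◅ ⇝*-prefix (_ ∷ []) (slide-past t i o l rs)
    where
    room : off + p + i′ ≤ off + (p + i′ + r) + t
    room = subst (off + p + i′ ≤_) (sym (regroup off p i′ r t)) (m≤m+n (off + p + i′) (r + t))
      where
      regroup : ∀ off p i r t → off + (p + i + r) + t ≡ off + p + i + (r + t)
      regroup = solve-∀
    height : (off + (p + i′ + r) + t + o′) ∸ i′ ≡ off + (p + o′ + r) + t
    height = trans (cong (_∸ i′) (regroup off p i′ r t o′)) (m+n∸m≡n i′ _)
      where
      regroup : ∀ off p i r t o → off + (p + i + r) + t + o ≡ i + (off + (p + o + r) + t)
      regroup = solve-∀

  block-past : ∀ {off w w′ F} K → Layered off w F w′ →
               (shift (off + w) K ++ F) ⇝* (F ++ shift (off + w′) K)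
  block-past {F = F} [] _ = ≡⇒⇝* (sym (++-identityʳ F))
  block-past {off} {w} {w′} {F} (⟨ t , i , o , l ⟩ ∷ K) layered =
    ⇝*-prefix (_ ∷ []) (block-past K layered) ◅◅
    ⇝*-suffix (shift (off + w′) K) (slide-past t i o l layered) ◅◅
    ≡⇒⇝* (++-assoc F _ (shift (off + w′) K))

  -- The two sides of the interchange law have diagrams that differ by moving
  -- the diagram of k past the diagram of f.
  interchange-exchanges : ∀ {A B C D E F f g h k} → f ⦂ B ⇒ C → g ⦂ A ⇒ B → h ⦂ E ⇒ F → k ⦂ D ⇒ E →
    ∀ off → conv-list ((f ⊗E h) ∘E (g ⊗E k)) off ⇝* conv-list ((f ∘E g) ⊗E (h ∘E k)) off
  interchange-exchanges {B = B} {C} {f = f} {g} {h} {k} p q _ _ off = begin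
    (G ++ K₁) ++ F′ ++ H′   ≡⟨ regroup K₁ F′ ⟩
    G ++ (K₁ ++ F′) ++ H′   ⟶*⟨ ⇝*-prefix G (⇝*-suffix H′ k-past-f) ⟩
    G ++ (F′ ++ K₂) ++ H′   ≡⟨ regroup F′ K₂ ⟨
    (G ++ F′) ++ K₂ ++ H′   ∎
    where
    open StarReasoning Exch
    G F′ H′ K₁ K₂ : List Ent
    G  = conv-list g off
    F′ = conv-list f off
    H′ = conv-list h (off + #out f off)
    K₁ = conv-list k (off + #out g off)
    K₂ = conv-list k (off + #out f off)
    regroup : ∀ X Y → (G ++ X) ++ Y ++ H′ ≡ G ++ (X ++ Y) ++ H′
    regroup X Y = trans (++-assoc G X (Y ++ H′)) (cong (G ++_) (sym (++-assoc X Y H′)))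
    k-after : ∀ {x X Y} → x ⦂ Y ⇒ X → conv-list k (off + #out x off) ≡ shift (off + length X) (conv-list k 0)
    k-after t = trans (cong (λ n → conv-list k (off + n)) (proj₂ (conv-arity t off))) (conv-list-shift₀ k _)
    k-past-f : (K₁ ++ F′) ⇝* (F′ ++ K₂)
    k-past-f = begin
      K₁ ++ F′                                     ≡⟨ cong (_++ F′) (k-after q) ⟩
      shift (off + length B) (conv-list k 0) ++ F′ ⟶*⟨ block-past (conv-list k 0) (conv-layered p off) ⟩
      F′ ++ shift (off + length C) (conv-list k 0) ≡⟨ cong (F′ ++_) (k-after p) ⟨
      F′ ++ K₂                                     ∎

  same⇒⇝* : ∀ {A B f g} → Same Sg A B f g → ∀ off → conv-list f off ⇝* conv-list g off
  same⇒⇝* (≈-refl _)     off = ε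
  same⇒⇝* (≈-sym s)      off = ⇝*-sym (same⇒⇝* s off)
  same⇒⇝* (≈-trans s s′) off = same⇒⇝* s off ◅◅ same⇒⇝* s′ off
  same⇒⇝* (≈-∘ s s′)     off = ⇝*-++ (same⇒⇝* s′ off) (same⇒⇝* s off)
  same⇒⇝* (≈-⊗ s s′)     off
    rewrite trans (proj₂ (conv-arity (proj₁ (same-typed s)) off)) (sym (proj₂ (conv-arity (proj₂ (same-typed s)) off))) =
    ⇝*-++ (same⇒⇝* s off) (same⇒⇝* s′ _)
  same⇒⇝* (∘-assoc {f = f} {g} {h} _ _ _) off = ≡⇒⇝* (sym (++-assoc (conv-list h off) (conv-list g off) (conv-list f off)))
  same⇒⇝* (∘-idˡ {f = f} _) off = ≡⇒⇝* (++-identityʳ (conv-list f off))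
  same⇒⇝* (∘-idʳ _)         off = ε
  same⇒⇝* (⊗-assoc {f = f} {g} {h} _ _ _) off =
    ≡⇒⇝* (trans (++-assoc (conv-list f off) _ _)
                (cong (λ n → conv-list f off ++ conv-list g (off + #out f off) ++ conv-list h n)
                      (sym (+-assoc off (#out f off) (#out g (off + #out f off))))))
  same⇒⇝* (⊗-unitˡ {f = f} _) off = ≡⇒⇝* (cong (conv-list f) (+-identityʳ off))
  same⇒⇝* (⊗-unitʳ {f = f} _) off = ≡⇒⇝* (++-identityʳ (conv-list f off))
  same⇒⇝* (⊗-id A B)         off = ε
  same⇒⇝* (interchange p q r s) off = interchange-exchanges p q r s off

  ⇝*⇒Exchanges : ∀ {s xs ys} → xs ⇝* ys → Exchanges Sg (diagram s xs) (diagram s ys)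
  ⇝*⇒Exchanges = gmap (diagram _) λ { (inj₁ r) → right r ; (inj₂ r) → left r }

  same⇒exchanges : ∀ {A B φ ψ} → Same Sg A B φ ψ → Exchanges Sg (labelledDiagram Sg φ) (labelledDiagram Sg ψ)
  same⇒exchanges s
    rewrite proj₁ (conv-arity (proj₁ (same-typed s)) 0) | proj₁ (conv-arity (proj₂ (same-typed s)) 0) =
    ⇝*⇒Exchanges (same⇒⇝* s 0)

  exchanges⇒same : ∀ {A B φ ψ} → φ ⦂ A ⇒ B → ψ ⦂ A ⇒ B →
                   Exchanges Sg (labelledDiagram Sg φ) (labelledDiagram Sg ψ) → Same Sg A B φ ψ
  exchanges⇒same {A} {φ = φ} {ψ} tφ tψ ex = ≋⇒Same tφ (
    φ                          ≋⟨ Represents.reads (conv-represents tφ) ⟩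
    readback A (conv-list φ 0) ≋⟨ proj₂ (proj₂ (exchanges-agree ex A (Represents.valid (conv-represents tφ)))) ⟩
    ≋-sym (Represents.reads (conv-represents tψ)))

theorem16 : (Sg : Signature) (A B : Word Sg) (φ ψ : Expr Sg) →
    _∶_⇒_ Sg φ A B → _∶_⇒_ Sg ψ A B →
    (Same Sg A B φ ψ → Exchanges Sg (labelledDiagram Sg φ) (labelledDiagram Sg ψ))
    × (Exchanges Sg (labelledDiagram Sg φ) (labelledDiagram Sg ψ) → Same Sg A B φ ψ)
theorem16 Sg A B φ ψ tφ tψ = same⇒exchanges Sg , exchanges⇒same Sg tφ tψ
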